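{- Let $n\ge 1$ and let $m\in\{3,5,6\}$ or $m=2^k$ for some integer $k\ge 2$. Then the grid graph $P_m\times P_n$ is odd prime.
   Context: All graphs are finite and simple. An odd prime labeling of a graph $G$ with $N$ vertices is a bijection $\ell:V(G)\to\{1,3,\dots,2N-1\}$ such that $\gcd(\ell(u),\ell(v))=1$ for every edge $uv$; $G$ is odd prime if it has one. $P_r$ denotes the path on $r$ vertices, and the grid graph $P_m\times P_n$ is the Cartesian product of $P_m$ and $P_n$: vertices $(a,b)$ with $1\le a\le m$, $1\le b\le n$, where $(a,b)$ and $(a',b')$ are adjacent iff ($a=a'$ and $|b-b'|=1$) or ($b=b'$ and $|a-a'|=1$). -}

module Defs where

open import Data.Nat using (ℕ; suc; _+_; _*_; _^_; _≤_)
open import Data.Nat.GCD using (gcd)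
open import Data.Fin using (Fin; toℕ)
open import Data.Product using (_×_; Σ; _,_)
open import Data.Sum using (_⊎_)
open import Relation.Binary.PropositionalEquality using (_≡_)
open import Function.Bundles using (_⤖_; Bijection)

oddVal : {N : ℕ} → Fin N → ℕ
oddVal i = 2 * toℕ i + 1

-- An odd prime labeling of a graph with vertex type V (of size N) and
-- adjacency relation Adj: a bijection ℓ : V → {1,3,...,2N-1} (encoded as a
-- bijection V ⤖ Fin N composed with oddVal) such that adjacent vertices
-- receive coprime labels.
OddPrimeLabeling : (V : Set) (N : ℕ) (Adj : V → V → Set) → Set
OddPrimeLabeling V N Adj =
  Σ (V ⤖ Fin N) λ ℓ →
    ∀ u v → Adj u v →
      gcd (oddVal (Bijection.to ℓ u)) (oddVal (Bijection.to ℓ v)) ≡ 1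

Adj1 : ℕ → ℕ → Set
Adj1 x y = (suc x ≡ y) ⊎ (suc y ≡ x)

GridAdj : (m n : ℕ) → Fin m × Fin n → Fin m × Fin n → Set
GridAdj m n (a , b) (a' , b') =
  (a ≡ a' × Adj1 (toℕ b) (toℕ b')) ⊎ (b ≡ b' × Adj1 (toℕ a) (toℕ a'))

GridOddPrime : (m n : ℕ) → Set
GridOddPrime m n = OddPrimeLabeling (Fin m × Fin n) (m * n) (GridAdj m n)

-- Two odd numbers differing by a power of 2 are coprime, since any common divisor is odd
-- and divides that power.  So it suffices to number the vertices 0 … mn−1 so that adjacent
-- vertices get numbers differing by a power of 2, and label vertex i by 2i+1.  Column b of
-- the grid receives the block m b, …, m b + m − 1 in the order given by a permutation σ_b.
-- For m = 2ᵏ the identity works (vertical steps are 1, horizontal steps are 2ᵏ); for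
-- m = 3, 5, 6 the σ_b cycle periodically through a few explicit permutations.
module Submission where

open import Defs
open import Data.Nat using (ℕ; zero; suc; _+_; _*_; _^_; _≤_; _≟_)
open import Data.Nat.Properties using (+-comm; *-comm; +-assoc)
open import Data.Nat.Divisibility using (∣-trans; ∣1⇒≡1; ∣m+n∣m⇒∣n; divides)
open import Data.Nat.Coprimality as Coprime using (Coprime; coprime-+; coprime-divisor; coprime⇒gcd≡1)
open import Data.Nat.Tactic.RingSolver using (solve-∀)
open import Data.Fin using (Fin; toℕ; #_)
open import Data.Fin.Properties using (toℕ-cast; toℕ-combine; *↔×; all?; any?)
import Data.Fin.Properties as Fin
open import Data.Fin.Permutation as Perm using (Permutation′; permutation; _⟨$⟩ʳ_; _⟨$⟩ˡ_; inverseˡ; inverseʳ; cast-id)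
open import Data.Vec using (Vec; []; _∷_; lookup)
open import Data.Product using (Σ; ∃-syntax; _×_; _,_; proj₁; proj₂)
open import Data.Sum using (_⊎_; inj₁; inj₂)
open import Relation.Nullary.Decidable using (Dec; True; toWitness; _⊎-dec_; _×-dec_; _→-dec_)
open import Relation.Binary.PropositionalEquality using (_≡_; refl; sym; trans; cong; subst; subst₂)
open import Function.Bundles using (_↔_; _⤖_; Bijection; mk↔ₛ′; Inverse)
open import Function.Properties.Inverse using (↔-sym; ↔-trans; ↔⇒⤖)

PowerOf2ApartBy : ℕ → ℕ → ℕ → Set
PowerOf2ApartBy e i j = i + 2 ^ e ≡ j ⊎ j + 2 ^ e ≡ i

PowerOf2Apart : ℕ → ℕ → Set
PowerOf2Apart i j = ∃[ e ] PowerOf2ApartBy e i j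

PowerOf2Apart-sym : ∀ {i j} → PowerOf2Apart i j → PowerOf2Apart j i
PowerOf2Apart-sym (e , inj₁ i+2ᵉ≡j) = e , inj₂ i+2ᵉ≡j
PowerOf2Apart-sym (e , inj₂ j+2ᵉ≡i) = e , inj₁ j+2ᵉ≡i

PowerOf2Apart-+ˡ : ∀ k {i j} → PowerOf2Apart i j → PowerOf2Apart (k + i) (k + j)
PowerOf2Apart-+ˡ k (e , inj₁ i+2ᵉ≡j) = e , inj₁ (trans (+-assoc k _ (2 ^ e)) (cong (k +_) i+2ᵉ≡j))
PowerOf2Apart-+ˡ k (e , inj₂ j+2ᵉ≡i) = e , inj₂ (trans (+-assoc k _ (2 ^ e)) (cong (k +_) j+2ᵉ≡i))

odd-coprime-2 : ∀ t → Coprime (2 * t + 1) 2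
odd-coprime-2 t (d∣2t+1 , d∣2) = ∣1⇒≡1 (∣m+n∣m⇒∣n d∣2t+1 (∣-trans d∣2 (divides t (*-comm 2 t))))

coprime-^ : ∀ {m n} e → Coprime m n → Coprime m (n ^ e)
coprime-^ zero    _ (_ , d∣1) = ∣1⇒≡1 d∣1
coprime-^ (suc e) c (d∣m , d∣n*nᵉ) =
  coprime-^ e c (d∣m , coprime-divisor (λ (i∣d , i∣n) → c (∣-trans i∣d d∣m , i∣n)) d∣n*nᵉ)

coprime-odd-+-2^ : ∀ t e → Coprime (2 * t + 1) (2 * t + 1 + 2 ^ e)
coprime-odd-+-2^ t e = Coprime.sym (coprime-+ (Coprime.sym (coprime-^ e (odd-coprime-2 t))))

-- An index difference of 2ᵉ is a difference of 2ᵉ⁺¹ between the odd labels.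
coprime-odd-index-+-2^ : ∀ i e → Coprime (2 * i + 1) (2 * (i + 2 ^ e) + 1)
coprime-odd-index-+-2^ i e =
  subst (Coprime (2 * i + 1)) (double-+ i (2 ^ e)) (coprime-odd-+-2^ i (suc e))
  where
  double-+ : ∀ x y → 2 * x + 1 + 2 * y ≡ 2 * (x + y) + 1
  double-+ = solve-∀

PowerOf2Apart⇒coprime : ∀ {i j} → PowerOf2Apart i j → Coprime (2 * i + 1) (2 * j + 1)
PowerOf2Apart⇒coprime {i} (e , inj₁ refl) = coprime-odd-index-+-2^ i e
PowerOf2Apart⇒coprime {j = j} (e , inj₂ refl) = Coprime.sym (coprime-odd-index-+-2^ j e)

oddPrimeLabeling : ∀ {V N} {Adj : V → V → Set} (ℓ : V ⤖ Fin N) →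
  (∀ u v → Adj u v → PowerOf2Apart (toℕ (Bijection.to ℓ u)) (toℕ (Bijection.to ℓ v))) →
  OddPrimeLabeling V N Adj
oddPrimeLabeling ℓ apart = ℓ , λ u v uv → coprime⇒gcd≡1 (PowerOf2Apart⇒coprime (apart u v uv))

gridIndexing : ∀ {m n} → (Fin n → Permutation′ m) → (Fin m × Fin n) ↔ Fin (m * n)
gridIndexing {m} {n} σ = ↔-trans twist (↔-trans (↔-sym (*↔× {n} {m})) (cast-id (*-comm n m)))
  where
  twist : (Fin m × Fin n) ↔ (Fin n × Fin m)
  twist = mk↔ₛ′ (λ (a , b) → b , σ b ⟨$⟩ʳ a) (λ (b , c) → σ b ⟨$⟩ˡ c , b)
    (λ (b , c) → cong (b ,_) (inverseʳ (σ b)))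
    (λ (a , b) → cong (_, b) (inverseˡ (σ b)))

toℕ-gridIndexing : ∀ {m n} (σ : Fin n → Permutation′ m) a b →
  toℕ (Inverse.to (gridIndexing σ) (a , b)) ≡ m * toℕ b + toℕ (σ b ⟨$⟩ʳ a)
toℕ-gridIndexing σ a b = trans (toℕ-cast _ _) (toℕ-combine b (σ b ⟨$⟩ʳ a))

-- Column b is ordered by the permutation of phase nextᵇ start.
record GridScheme (m q : ℕ) : Set where
  field
    perm       : Fin q → Permutation′ m
    next       : Fin q → Fin q
    start      : Fin q
    vertical   : ∀ r {a a' : Fin m} → suc (toℕ a) ≡ toℕ a' →
                 PowerOf2Apart (toℕ (perm r ⟨$⟩ʳ a)) (toℕ (perm r ⟨$⟩ʳ a'))
    horizontal : ∀ r a → PowerOf2Apart (toℕ (perm r ⟨$⟩ʳ a)) (m + toℕ (perm (next r) ⟨$⟩ʳ a))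

module _ {m q} (S : GridScheme m q) (n : ℕ) where
  open GridScheme S

  phase : ℕ → Fin q
  phase zero    = start
  phase (suc b) = next (phase b)

  column : Fin n → Permutation′ m
  column b = perm (phase (toℕ b))

  index : Fin m × Fin n → ℕ
  index (a , b) = m * toℕ b + toℕ (column b ⟨$⟩ʳ a)

  index-next-column : ∀ a {b b' : Fin n} → suc (toℕ b) ≡ toℕ b' →
    PowerOf2Apart (index (a , b)) (index (a , b'))
  index-next-column a {b} {b'} b+1≡b' rewrite sym b+1≡b' =
    subst (PowerOf2Apart (index (a , b)))
      (shift m (toℕ b) (toℕ (perm (phase (suc (toℕ b))) ⟨$⟩ʳ a)))
      (PowerOf2Apart-+ˡ (m * toℕ b) (horizontal (phase (toℕ b)) a))
    where
    shift : ∀ m t x → m * t + (m + x) ≡ m * suc t + x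
    shift = solve-∀

  index-apart : ∀ u v → GridAdj m n u v → PowerOf2Apart (index u) (index v)
  index-apart (a , _) _ (inj₁ (refl , inj₁ b+1≡b')) = index-next-column a b+1≡b'
  index-apart (a , _) _ (inj₁ (refl , inj₂ b'+1≡b)) = PowerOf2Apart-sym (index-next-column a b'+1≡b)
  index-apart (_ , b) _ (inj₂ (refl , inj₁ a+1≡a')) =
    PowerOf2Apart-+ˡ (m * toℕ b) (vertical (phase (toℕ b)) a+1≡a')
  index-apart (_ , b) _ (inj₂ (refl , inj₂ a'+1≡a)) =
    PowerOf2Apart-sym (PowerOf2Apart-+ˡ (m * toℕ b) (vertical (phase (toℕ b)) a'+1≡a))

  gridOddPrime : GridOddPrime m n
  gridOddPrime = oddPrimeLabeling (↔⇒⤖ (gridIndexing column)) λ (a , b) (a' , b') uv →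
    subst₂ PowerOf2Apart (sym (toℕ-gridIndexing column a b)) (sym (toℕ-gridIndexing column a' b'))
      (index-apart (a , b) (a' , b') uv)

powerOf2GridScheme : ∀ k → GridScheme (2 ^ k) 1
powerOf2GridScheme k = record
  { perm       = λ _ → Perm.id
  ; next       = λ r → r
  ; start      = # 0
  ; vertical   = λ _ {a} a+1≡a' → 0 , inj₁ (trans (+-comm (toℕ a) 1) a+1≡a')
  ; horizontal = λ _ a → k , inj₁ (+-comm (toℕ a) (2 ^ k))
  }

powerOf2ApartBy? : ∀ e i j → Dec (PowerOf2ApartBy e i j)
powerOf2ApartBy? e i j = (i + 2 ^ e ≟ j) ⊎-dec (j + 2 ^ e ≟ i)

PowerOf2ApartBelow : ℕ → ℕ → ℕ → Set
PowerOf2ApartBelow k i j = Σ (Fin k) λ e → PowerOf2ApartBy (toℕ e) i j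

PowerOf2ApartBelow⇒PowerOf2Apart : ∀ {k i j} → PowerOf2ApartBelow k i j → PowerOf2Apart i j
PowerOf2ApartBelow⇒PowerOf2Apart (e , apart) = toℕ e , apart

powerOf2ApartBelow? : ∀ k i j → Dec (PowerOf2ApartBelow k i j)
powerOf2ApartBelow? k i j = any? λ e → powerOf2ApartBy? (toℕ e) i j

-- All conditions are decided by evaluation, searching for exponents below k.
module Tabulated {m q} (rows inverses : Vec (Vec (Fin m) m) q) (nexts : Vec (Fin q) q) (k : ℕ) where
  σ σ⁻¹ : Fin q → Fin m → Fin m
  σ   r = lookup (lookup rows r)
  σ⁻¹ r = lookup (lookup inverses r)

  inverse? : Dec (∀ r a → σ⁻¹ r (σ r a) ≡ a × σ r (σ⁻¹ r a) ≡ a)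
  inverse? = all? λ r → all? λ a → (σ⁻¹ r (σ r a) Fin.≟ a) ×-dec (σ r (σ⁻¹ r a) Fin.≟ a)

  vertical? : Dec (∀ r a a' → suc (toℕ a) ≡ toℕ a' →
    PowerOf2ApartBelow k (toℕ (σ r a)) (toℕ (σ r a')))
  vertical? = all? λ r → all? λ a → all? λ a' →
    (suc (toℕ a) ≟ toℕ a') →-dec powerOf2ApartBelow? k _ _

  horizontal? : Dec (∀ r a → PowerOf2ApartBelow k (toℕ (σ r a)) (m + toℕ (σ (lookup nexts r) a)))
  horizontal? = all? λ r → all? λ a → powerOf2ApartBelow? k _ _

  scheme : Fin q → True inverse? → True vertical? → True horizontal? → GridScheme m q
  scheme start inv vert horiz = record
    { perm       = λ r → permutation (σ r) (σ⁻¹ r)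
                     (λ a → proj₂ (toWitness inv r a))
                     (λ a → proj₁ (toWitness inv r a))
    ; next       = lookup nexts
    ; start      = start
    ; vertical   = λ r {a} {a'} a+1≡a' →
                     PowerOf2ApartBelow⇒PowerOf2Apart (toWitness vert r a a' a+1≡a')
    ; horizontal = λ r a → PowerOf2ApartBelow⇒PowerOf2Apart (toWitness horiz r a)
    }

gridScheme3 : GridScheme 3 3
gridScheme3 = Tabulated.scheme rows inverses (# 1 ∷ # 2 ∷ # 0 ∷ []) 4 (# 0) _ _ _
  where
  rows inverses : Vec (Vec (Fin 3) 3) 3
  rows     = (# 0 ∷ # 1 ∷ # 2 ∷ []) ∷ (# 1 ∷ # 2 ∷ # 0 ∷ []) ∷ (# 2 ∷ # 0 ∷ # 1 ∷ []) ∷ []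
  inverses = (# 0 ∷ # 1 ∷ # 2 ∷ []) ∷ (# 2 ∷ # 0 ∷ # 1 ∷ []) ∷ (# 1 ∷ # 2 ∷ # 0 ∷ []) ∷ []

gridScheme5 : GridScheme 5 5
gridScheme5 = Tabulated.scheme rows inverses (# 1 ∷ # 2 ∷ # 3 ∷ # 4 ∷ # 0 ∷ []) 4 (# 0) _ _ _
  where
  rows inverses : Vec (Vec (Fin 5) 5) 5
  rows     = (# 0 ∷ # 1 ∷ # 3 ∷ # 4 ∷ # 2 ∷ []) ∷ (# 3 ∷ # 4 ∷ # 2 ∷ # 0 ∷ # 1 ∷ [])
           ∷ (# 2 ∷ # 0 ∷ # 1 ∷ # 3 ∷ # 4 ∷ []) ∷ (# 1 ∷ # 3 ∷ # 4 ∷ # 2 ∷ # 0 ∷ [])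
           ∷ (# 4 ∷ # 2 ∷ # 0 ∷ # 1 ∷ # 3 ∷ []) ∷ []
  inverses = (# 0 ∷ # 1 ∷ # 4 ∷ # 2 ∷ # 3 ∷ []) ∷ (# 3 ∷ # 4 ∷ # 2 ∷ # 0 ∷ # 1 ∷ [])
           ∷ (# 1 ∷ # 2 ∷ # 0 ∷ # 3 ∷ # 4 ∷ []) ∷ (# 4 ∷ # 0 ∷ # 3 ∷ # 1 ∷ # 2 ∷ [])
           ∷ (# 2 ∷ # 3 ∷ # 1 ∷ # 4 ∷ # 0 ∷ []) ∷ []

gridScheme6 : GridScheme 6 3
gridScheme6 = Tabulated.scheme rows inverses (# 1 ∷ # 2 ∷ # 0 ∷ []) 4 (# 0) _ _ _
  where
  rows inverses : Vec (Vec (Fin 6) 6) 3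
  rows     = (# 0 ∷ # 1 ∷ # 3 ∷ # 2 ∷ # 4 ∷ # 5 ∷ []) ∷ (# 2 ∷ # 3 ∷ # 5 ∷ # 4 ∷ # 0 ∷ # 1 ∷ [])
           ∷ (# 4 ∷ # 5 ∷ # 1 ∷ # 0 ∷ # 2 ∷ # 3 ∷ []) ∷ []
  inverses = (# 0 ∷ # 1 ∷ # 3 ∷ # 2 ∷ # 4 ∷ # 5 ∷ []) ∷ (# 4 ∷ # 5 ∷ # 0 ∷ # 1 ∷ # 3 ∷ # 2 ∷ [])
           ∷ (# 3 ∷ # 2 ∷ # 4 ∷ # 5 ∷ # 0 ∷ # 1 ∷ []) ∷ []

mainTheorem10 : (m n : ℕ) → 1 ≤ n →
    (m ≡ 3 ⊎ m ≡ 5 ⊎ m ≡ 6 ⊎ Σ ℕ (λ k → 2 ≤ k × m ≡ 2 ^ k)) →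
    GridOddPrime m n
mainTheorem10 _ n _ (inj₁ refl)                        = gridOddPrime gridScheme3 n
mainTheorem10 _ n _ (inj₂ (inj₁ refl))                 = gridOddPrime gridScheme5 n
mainTheorem10 _ n _ (inj₂ (inj₂ (inj₁ refl)))          = gridOddPrime gridScheme6 n
mainTheorem10 _ n _ (inj₂ (inj₂ (inj₂ (k , _ , refl)))) = gridOddPrime (powerOf2GridScheme k) n
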